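{- The number of graphical splitted bipartite degree sequences on $n+n$ vertices whose canonical decomposition contains only components with at most $6$ primary and at most $6$ secondary vertices is $\Omega(4.99^n)$.
   Context: A splitted bipartite degree sequence is the degree sequence of a bipartite graph with designated primary and secondary classes, with the degrees of the two classes listed separately; $n+n$ vertices means $n$ in each class. It is graphical if it is realized by some simple bipartite graph. Composition is defined by $\langle\mathfrak{u},\mathfrak{w}\rangle\circ\langle\mathfrak{x},\mathfrak{y}\rangle=\langle(\mathfrak{u}\oplus|\mathfrak{y}|,\ \mathfrak{x}),\ (\mathfrak{w},\ \mathfrak{y}\oplus|\mathfrak{u}|)\rangle$, where $\oplus c$ adds $c$ to every entry and $|\cdot|$ is the length; it corresponds to adding all edges between the first primary class and the second secondary class. A sequence is indecomposable if it is not a composition of two sequences each with at least one vertex. The canonical decomposition is the unique expression of a sequence as a composition of indecomposable ones. -}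

module Defs where

open import Data.Nat using (ℕ; zero; suc; _+_; _*_; _^_; _≤_; _≥_)
open import Data.Bool using (Bool; if_then_else_)
open import Data.Fin using (Fin)
open import Data.Nat.ListAction using (sum)
open import Data.List using (List; []; _∷_; _++_; map; length; lookup; allFin; foldr)
open import Data.List.Relation.Unary.All using (All)
open import Data.List.Relation.Unary.Linked using (Linked)
open import Data.List.Relation.Unary.Unique.Propositional using (Unique)
open import Data.Product using (_×_; _,_; Σ; ∃; ∃₂; proj₁; proj₂)
open import Relation.Nullary using (¬_)
open import Relation.Binary.PropositionalEquality using (_≡_)

-- Convention: primary listed non-increasingly, secondary non-decreasingly
-- (this is the ordering preserved by the composition below).
SBDS : Set
SBDS = List ℕ × List ℕ

primary : SBDS → List ℕ
primary = proj₁

secondary : SBDS → List ℕ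
secondary = proj₂

vertices : SBDS → ℕ
vertices s = length (primary s) + length (secondary s)

_⊕_ : List ℕ → ℕ → List ℕ
u ⊕ c = map (λ x → x + c) u

_∘ₛ_ : SBDS → SBDS → SBDS
(u , w) ∘ₛ (x , y) = (u ⊕ length y ++ x , w ++ y ⊕ length u)

composeAll : List SBDS → SBDS
composeAll = foldr _∘ₛ_ ([] , [])

Ordered : SBDS → Set
Ordered (u , w) = Linked _≥_ u × Linked _≤_ w

bdeg : {p q : ℕ} → (Fin p → Fin q → Bool) → Fin p → ℕ
bdeg {q = q} E i = sum (map (λ j → if E i j then 1 else 0) (allFin q))

bdeg′ : {p q : ℕ} → (Fin p → Fin q → Bool) → Fin q → ℕ
bdeg′ {p = p} E j = sum (map (λ i → if E i j then 1 else 0) (allFin p))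

Graphical : SBDS → Set
Graphical (u , w) =
  Σ (Fin (length u) → Fin (length w) → Bool) λ E →
    ((i : Fin (length u)) → bdeg E i ≡ lookup u i) ×
    ((j : Fin (length w)) → bdeg′ E j ≡ lookup w j)

Valid : SBDS → Set
Valid s = Ordered s × Graphical s

Indecomposable : SBDS → Set
Indecomposable s =
  ¬ (∃₂ λ a b → Valid a × Valid b × 1 ≤ vertices a × 1 ≤ vertices b × s ≡ a ∘ₛ b)

SmallComponent : SBDS → Set
SmallComponent c = length (primary c) ≤ 6 × length (secondary c) ≤ 6

-- the canonical decomposition consists only of components with ≤ 6 + ≤ 6 vertices
-- (by uniqueness of the canonical decomposition: some decomposition into
--  indecomposables has only such components)
OnlySmallComponents : SBDS → Set
OnlySmallComponents s =
  ∃ λ cs → All (λ c → Valid c × Indecomposable c × 1 ≤ vertices c × SmallComponent c) cs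
         × s ≡ composeAll cs

Counted : ℕ → SBDS → Set
Counted n s = length (primary s) ≡ n × length (secondary s) ≡ n × Valid s × OnlySmallComponents s

{-# OPTIONS --safe #-}
module Submission where

-- Twenty-three small indecomposable sequences serve as letters: each comes with an explicit
-- realization, and none has a proper split of its degree lists that is balanced, i.e. on which
-- the degree-sum formula holds as it must for a split s = a ∘ₛ b.  Compositions of letters are
-- valid, have only small components, and different words give different sequences: composition
-- is left-cancellative, and two distinct letters are told apart by one degree position in every
-- composition starting with them.  To count words with a primary and b secondary vertices we use
-- a potential V(a - b), a subsolution of the transfer equation of the letters at growth 2.234 per
-- vertex; induction on a + b gives V(a - b) · 2.234^(a+b) = O(#words), and 2.234² > 4.99.

open import Defs
open import Data.Nat.Properties
open import Algebra.Properties.CommutativeMonoid.Sum +-0-commutativeMonoid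
  using (∑-comm; sum-cong-≗) renaming (sum to ∑)
open import Algebra.Properties.CommutativeSemigroup +-commutativeSemigroup
  using (interchange; x∙yz≈y∙xz; x∙yz≈yx∙z; xy∙z≈xz∙y; xy∙z≈x∙zy)
open import Algebra.Properties.CommutativeSemigroup *-commutativeSemigroup
  using () renaming (interchange to *-interchange)
open import Data.Bool using (Bool; true; false; if_then_else_)
open import Data.Bool.ListAction using (any)
open import Data.Bool.Properties using (T?)
open import Data.Fin using (Fin; toℕ)
import Data.Fin as Fin
open import Data.List
  using (List; []; _∷_; _++_; map; length; lookup; tabulate; applyUpTo; take; foldr; upTo; concatMap)
open import Data.List.Membership.Propositional using (_∈_)
open import Data.List.Membership.Propositional.Properties using (∈-map⁻)
open import Data.List.Properties
  using (≡-dec; ∷-injectiveˡ; ∷-injectiveʳ; map-injective; ++-cancelˡ; length-map; length-++;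
         map-applyUpTo; map-tabulate; tabulate-lookup)
open import Data.List.Relation.Binary.Disjoint.Propositional using (Disjoint)
open import Data.List.Relation.Unary.All using (All; []; _∷_)
import Data.List.Relation.Unary.All as All
import Data.List.Relation.Unary.All.Properties as AllP
open import Data.List.Relation.Unary.AllPairs using (AllPairs; allPairs?)
import Data.List.Relation.Unary.AllPairs as AllPairs
import Data.List.Relation.Unary.AllPairs.Properties as AllPairsP
open import Data.List.Relation.Unary.Any using (here; there)
open import Data.List.Relation.Unary.Linked using (Linked; linked?)
import Data.List.Relation.Unary.Linked as Linked
import Data.List.Relation.Unary.Linked.Properties as LinkedP
open import Data.List.Relation.Unary.Unique.Propositional using (Unique)
import Data.List.Relation.Unary.Unique.Propositional.Properties as UniqueP
open import Data.Maybe using (Maybe; nothing; _<∣>_; is-just; to-witness-T)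
import Data.Maybe as Maybe
open import Data.Nat
  using (ℕ; NonZero; zero; suc; _+_; _*_; _∸_; _^_; _≤_; _<_; z≤n; s≤s; z<s; s<s; _≤?_; _<?_; _≟_; _≡ᵇ_)
open import Data.Nat.ListAction using (sum)
open import Data.Nat.ListAction.Properties using (sum-++)
open import Data.Nat.Tactic.RingSolver using (solve-∀)
open import Data.Product using (_×_; _,_; ∃; proj₁; proj₂)
open import Data.Sum using (_⊎_; inj₁; inj₂)
open import Function using (_∘_; id; flip)
open import Relation.Binary.Definitions using (Transitive)
open import Relation.Binary.PropositionalEquality
open import Relation.Nullary using (¬_; Dec; yes; no; contradiction; ¬?; _×-dec_; _⊎-dec_; _→-dec_)
open import Relation.Nullary.Decidable using (from-yes; dec⇒maybe)

ind : Bool → ℕ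
ind b = if b then 1 else 0

ind≤1 : ∀ b → ind b ≤ 1
ind≤1 true  = ≤-refl
ind≤1 false = z≤n

applyUpTo-+ : ∀ {A : Set} (f : ℕ → A) m n →
              applyUpTo f (m + n) ≡ applyUpTo f m ++ applyUpTo (λ k → f (m + k)) n
applyUpTo-+ f zero    n = refl
applyUpTo-+ f (suc m) n = cong (f 0 ∷_) (applyUpTo-+ (f ∘ suc) m n)

applyUpTo-cong< : ∀ {A : Set} {f g : ℕ → A} n → (∀ {i} → i < n → f i ≡ g i) →
                  applyUpTo f n ≡ applyUpTo g n
applyUpTo-cong< zero    eq = refl
applyUpTo-cong< (suc n) eq = cong₂ _∷_ (eq z<s) (applyUpTo-cong< n (eq ∘ s<s))

applyUpTo-lookup : ∀ {A : Set} (xs : List A) {f : ℕ → A} → xs ≡ applyUpTo f (length xs) →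
                   ∀ i → lookup xs i ≡ f (toℕ i)
applyUpTo-lookup (x ∷ xs) eq Fin.zero    = ∷-injectiveˡ eq
applyUpTo-lookup (x ∷ xs) eq (Fin.suc i) = applyUpTo-lookup xs (∷-injectiveʳ eq) i

tabulate-toℕ : ∀ {A : Set} (f : ℕ → A) n → tabulate {n = n} (f ∘ toℕ) ≡ applyUpTo f n
tabulate-toℕ f zero    = refl
tabulate-toℕ f (suc n) = cong (f 0 ∷_) (tabulate-toℕ (f ∘ suc) n)

sum-applyUpTo-+ : ∀ f m n →
  sum (applyUpTo f (m + n)) ≡ sum (applyUpTo f m) + sum (applyUpTo (λ k → f (m + k)) n)
sum-applyUpTo-+ f m n = trans (cong sum (applyUpTo-+ f m n)) (sum-++ (applyUpTo f m) _)

sum-applyUpTo-const : ∀ {f} c n → (∀ {k} → k < n → f k ≡ c) → sum (applyUpTo f n) ≡ n * c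
sum-applyUpTo-const c zero    eq = refl
sum-applyUpTo-const c (suc n) eq = cong₂ _+_ (eq z<s) (sum-applyUpTo-const c n (eq ∘ s<s))

sum-applyUpTo-ind : ∀ g n → sum (applyUpTo (λ j → ind (g j)) n) ≤ n
sum-applyUpTo-ind g zero    = z≤n
sum-applyUpTo-ind g (suc n) = +-mono-≤ (ind≤1 (g 0)) (sum-applyUpTo-ind (g ∘ suc) n)

sum-tabulate : ∀ {n} (f : Fin n → ℕ) → sum (tabulate f) ≡ ∑ f
sum-tabulate {zero}  f = refl
sum-tabulate {suc n} f = cong (f Fin.zero +_) (sum-tabulate (f ∘ Fin.suc))

sum-⊕ : ∀ u c → sum (u ⊕ c) ≡ sum u + length u * c
sum-⊕ []      c = refl
sum-⊕ (a ∷ u) c = trans (cong (a + c +_) (sum-⊕ u c)) (interchange a c (sum u) _)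

sum-map-mono : ∀ {A : Set} {f g : A → ℕ} {xs} → All (λ x → f x ≤ g x) xs → sum (map f xs) ≤ sum (map g xs)
sum-map-mono []         = z≤n
sum-map-mono (le ∷ les) = +-mono-≤ le (sum-map-mono les)

sum-map-*ˡ : ∀ {A : Set} c (f : A → ℕ) xs → sum (map (λ x → c * f x) xs) ≡ c * sum (map f xs)
sum-map-*ˡ c f []       = sym (*-zeroʳ c)
sum-map-*ˡ c f (x ∷ xs) = trans (cong (c * f x +_) (sum-map-*ˡ c f xs)) (sym (*-distribˡ-+ c (f x) _))

sum-map-*ʳ : ∀ {A : Set} (f : A → ℕ) c xs → sum (map (λ x → f x * c) xs) ≡ sum (map f xs) * c
sum-map-*ʳ f c []       = refl
sum-map-*ʳ f c (x ∷ xs) = trans (cong (f x * c +_) (sum-map-*ʳ f c xs)) (sym (*-distribʳ-+ c (f x) _))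

take-length-++ : ∀ {A : Set} (xs ys : List A) → take (length xs) (xs ++ ys) ≡ xs
take-length-++ []       ys = refl
take-length-++ (x ∷ xs) ys = cong (x ∷_) (take-length-++ xs ys)

length-concatMap : ∀ {A B : Set} (g : A → List B) xs → length (concatMap g xs) ≡ sum (map (length ∘ g) xs)
length-concatMap g []       = refl
length-concatMap g (x ∷ xs) = trans (length-++ (g x)) (cong (length (g x) +_) (length-concatMap g xs))

length-≤-concatMap : ∀ {A B : Set} (g : A → List B) {x xs} → x ∈ xs → length (g x) ≤ length (concatMap g xs)
length-≤-concatMap g {xs = x ∷ xs} (here refl) =
  ≤-trans (m≤m+n _ _) (≤-reflexive (sym (length-++ (g x))))
length-≤-concatMap g {xs = y ∷ xs} (there x∈xs) =
  ≤-trans (length-≤-concatMap g x∈xs) (≤-trans (m≤n+m _ _) (≤-reflexive (sym (length-++ (g y)))))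

at : List ℕ → ℕ → ℕ
at []       _       = 0
at (x ∷ xs) zero    = x
at (x ∷ xs) (suc i) = at xs i

at-++ˡ : ∀ xs ys {i} → i < length xs → at (xs ++ ys) i ≡ at xs i
at-++ˡ (x ∷ xs) ys {zero}  _          = refl
at-++ˡ (x ∷ xs) ys {suc i} (s≤s i<n) = at-++ˡ xs ys i<n

at-⊕ : ∀ xs c {i} → i < length xs → at (xs ⊕ c) i ≡ at xs i + c
at-⊕ (x ∷ xs) c {zero}  _          = refl
at-⊕ (x ∷ xs) c {suc i} (s≤s i<n) = at-⊕ xs c i<n

at-++-⊕-≥ : ∀ xs ys c {j} → length xs ≤ j → j < length (xs ++ ys ⊕ c) → c ≤ at (xs ++ ys ⊕ c) j
at-++-⊕-≥ []       (y ∷ ys) c {zero}  _         _         = m≤n+m c y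
at-++-⊕-≥ []       (y ∷ ys) c {suc j} _         (s≤s j<n) = at-++-⊕-≥ [] ys c z≤n j<n
at-++-⊕-≥ (x ∷ xs) ys       c {suc j} (s≤s x≤j) (s≤s j<n) = at-++-⊕-≥ xs ys c x≤j j<n

at-≥ : ∀ xs {i} → length xs ≤ i → at xs i ≡ 0
at-≥ []       _         = refl
at-≥ (x ∷ xs) (s≤s le) = at-≥ xs le

exchange-cancel : ∀ a a′ y y′ w w′ → a + y ≡ a′ + y′ → w + y ≡ w′ + y′ → w′ + a ≡ w + a′
exchange-cancel a a′ y y′ w w′ e₁ e₂ = +-cancelʳ-≡ y _ _ (begin
  w′ + a + y     ≡⟨ +-assoc w′ a y ⟩
  w′ + (a + y)   ≡⟨ cong (w′ +_) e₁ ⟩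
  w′ + (a′ + y′) ≡⟨ x∙yz≈y∙xz w′ a′ y′ ⟩
  a′ + (w′ + y′) ≡⟨ cong (a′ +_) e₂ ⟨
  a′ + (w + y)   ≡⟨ x∙yz≈yx∙z a′ w y ⟩
  w + a′ + y     ∎)
  where open ≡-Reasoning

∸-exchange : ∀ m n x y → m + y ≡ n + x → m ∸ n ≡ x ∸ y
∸-exchange m n x y eq = begin
  m ∸ n             ≡⟨ [m+n]∸[m+o]≡n∸o y m n ⟨
  (y + m) ∸ (y + n) ≡⟨ cong₂ _∸_ (+-comm y m) (+-comm y n) ⟩
  (m + y) ∸ (n + y) ≡⟨ cong (_∸ (n + y)) eq ⟩
  (n + x) ∸ (n + y) ≡⟨ [m+n]∸[m+o]≡n∸o n x y ⟩
  x ∸ y             ∎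
  where open ≡-Reasoning

^-distribʳ-* : ∀ m n k → (m * n) ^ k ≡ m ^ k * n ^ k
^-distribʳ-* m n zero    = refl
^-distribʳ-* m n (suc k) = trans (cong (m * n *_) (^-distribʳ-* m n k)) (*-interchange m n (m ^ k) (n ^ k))

^-double : ∀ m n → m ^ (n + n) ≡ (m * m) ^ n
^-double m n = trans (^-distribˡ-+-* m n n) (sym (^-distribʳ-* m m n))

length-⊕ : ∀ u c → length (u ⊕ c) ≡ length u
length-⊕ u c = length-map (_+ c) u

primaryCount-∘ₛ : ∀ a b → length (primary (a ∘ₛ b)) ≡ length (primary a) + length (primary b)
primaryCount-∘ₛ (u , w) (x , y) = trans (length-++ (u ⊕ length y)) (cong (_+ length x) (length-⊕ u _))

secondaryCount-∘ₛ : ∀ a b → length (secondary (a ∘ₛ b)) ≡ length (secondary a) + length (secondary b)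
secondaryCount-∘ₛ (u , w) (x , y) = trans (length-++ w) (cong (length w +_) (length-⊕ y _))

vertices-∘ₛ : ∀ a b → vertices (a ∘ₛ b) ≡ vertices a + vertices b
vertices-∘ₛ a b = trans (cong₂ _+_ (primaryCount-∘ₛ a b) (secondaryCount-∘ₛ a b))
                        (interchange (length (primary a)) _ _ _)

∘ₛ-cancelˡ : ∀ ℓ {s s′} → ℓ ∘ₛ s ≡ ℓ ∘ₛ s′ → s ≡ s′
∘ₛ-cancelˡ (u , w) {x , y} {x′ , y′} eq
  with map-injective (+-cancelʳ-≡ (length u) _ _) (++-cancelˡ w (y ⊕ length u) _ (cong proj₂ eq))
... | refl = cong (_, y) (++-cancelˡ (u ⊕ length y) x x′ (cong proj₁ eq))

rowDegree : (ℕ → ℕ → Bool) → ℕ → ℕ → ℕ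
rowDegree F q i = sum (applyUpTo (λ j → ind (F i j)) q)

columnDegree : (ℕ → ℕ → Bool) → ℕ → ℕ → ℕ
columnDegree F p j = sum (applyUpTo (λ i → ind (F i j)) p)

-- Realizations are ℕ-indexed adjacency functions, so that composing them (block below) needs no
-- arithmetic on Fin; realizable⇒graphical recovers Graphical.
RealizedBy : (ℕ → ℕ → Bool) → SBDS → Set
RealizedBy F (u , w) = u ≡ applyUpTo (rowDegree F (length w)) (length u)
                     × w ≡ applyUpTo (columnDegree F (length u)) (length w)

Realizable : SBDS → Set
Realizable s = ∃ λ F → RealizedBy F s

realizable⇒graphical : ∀ {s} → Realizable s → Graphical s
realizable⇒graphical {u , w} (F , eu , ew) =
  E , (λ i → trans (bdeg-E i) (sym (applyUpTo-lookup u eu i)))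
    , (λ j → trans (bdeg′-E j) (sym (applyUpTo-lookup w ew j)))
  where
  E : Fin (length u) → Fin (length w) → Bool
  E i j = F (toℕ i) (toℕ j)
  bdeg-E : ∀ i → bdeg E i ≡ rowDegree F (length w) (toℕ i)
  bdeg-E i = cong sum (trans (map-tabulate id _) (tabulate-toℕ _ (length w)))
  bdeg′-E : ∀ j → bdeg′ E j ≡ columnDegree F (length u) (toℕ j)
  bdeg′-E j = cong sum (trans (map-tabulate id _) (tabulate-toℕ _ (length u)))

rowDegree≤ : ∀ F q i → rowDegree F q i ≤ q
rowDegree≤ F q i = sum-applyUpTo-ind (F i) q

columnDegree≤ : ∀ F p j → columnDegree F p j ≤ p
columnDegree≤ F p j = sum-applyUpTo-ind (flip F j) p

primaryDegrees≤ : ∀ {F u w} → RealizedBy F (u , w) → All (_≤ length w) u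
primaryDegrees≤ {F} (eu , _) =
  subst (All (_≤ _)) (sym eu) (AllP.applyUpTo⁺₂ _ _ (rowDegree≤ F _))

secondaryDegrees≤ : ∀ {F u w} → RealizedBy F (u , w) → All (_≤ length u) w
secondaryDegrees≤ {F} (_ , ew) =
  subst (All (_≤ _)) (sym ew) (AllP.applyUpTo⁺₂ _ _ (columnDegree≤ F _))

-- The adjacency of a ∘ₛ b: A and B on the diagonal, every primary of a joined to every secondary of b.
block : ℕ → ℕ → (ℕ → ℕ → Bool) → (ℕ → ℕ → Bool) → ℕ → ℕ → Bool
block p q A B i j with i <? p | j <? q
... | yes _ | yes _ = A i j
... | yes _ | no  _ = true
... | no  _ | yes _ = false
... | no  _ | no  _ = B (i ∸ p) (j ∸ q)

module _ {p q : ℕ} (A B : ℕ → ℕ → Bool) where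

  open ≡-Reasoning

  block-topLeft : ∀ {i j} → i < p → j < q → block p q A B i j ≡ A i j
  block-topLeft {i} {j} i<p j<q with i <? p | j <? q
  ... | yes _   | yes _   = refl
  ... | yes _   | no  j≮q = contradiction j<q j≮q
  ... | no  i≮p | _       = contradiction i<p i≮p

  block-topRight : ∀ {i} l → i < p → block p q A B i (q + l) ≡ true
  block-topRight {i} l i<p with i <? p | q + l <? q
  ... | yes _   | no  _     = refl
  ... | yes _   | yes q+l<q = contradiction q+l<q (m+n≮m q l)
  ... | no  i≮p | _         = contradiction i<p i≮p

  block-bottomLeft : ∀ k {j} → j < q → block p q A B (p + k) j ≡ false
  block-bottomLeft k {j} j<q with p + k <? p | j <? q
  ... | no  _     | yes _   = refl
  ... | no  _     | no  j≮q = contradiction j<q j≮q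
  ... | yes p+k<p | _       = contradiction p+k<p (m+n≮m p k)

  block-bottomRight : ∀ k l → block p q A B (p + k) (q + l) ≡ B k l
  block-bottomRight k l with p + k <? p | q + l <? q
  ... | no  _     | no  _     = cong₂ B (m+n∸m≡n p k) (m+n∸m≡n q l)
  ... | no  _     | yes q+l<q = contradiction q+l<q (m+n≮m q l)
  ... | yes p+k<p | _         = contradiction p+k<p (m+n≮m p k)

  rowDegree-block-top : ∀ q′ {i} → i < p → rowDegree (block p q A B) (q + q′) i ≡ rowDegree A q i + q′
  rowDegree-block-top q′ {i} i<p = begin
    rowDegree (block p q A B) (q + q′) i
      ≡⟨ sum-applyUpTo-+ _ q q′ ⟩
    rowDegree (block p q A B) q i + sum (applyUpTo (λ l → ind (block p q A B i (q + l))) q′)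
      ≡⟨ cong₂ _+_ (cong sum (applyUpTo-cong< q (cong ind ∘ block-topLeft i<p)))
                   (sum-applyUpTo-const 1 q′ (λ {l} _ → cong ind (block-topRight l i<p))) ⟩
    rowDegree A q i + q′ * 1
      ≡⟨ cong (rowDegree A q i +_) (*-identityʳ q′) ⟩
    rowDegree A q i + q′ ∎

  rowDegree-block-bottom : ∀ q′ k → rowDegree (block p q A B) (q + q′) (p + k) ≡ rowDegree B q′ k
  rowDegree-block-bottom q′ k = begin
    rowDegree (block p q A B) (q + q′) (p + k)
      ≡⟨ sum-applyUpTo-+ _ q q′ ⟩
    rowDegree (block p q A B) q (p + k) + sum (applyUpTo (λ l → ind (block p q A B (p + k) (q + l))) q′)
      ≡⟨ cong₂ _+_ (sum-applyUpTo-const 0 q (cong ind ∘ block-bottomLeft k))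
                   (cong sum (applyUpTo-cong< q′ (λ {l} _ → cong ind (block-bottomRight k l)))) ⟩
    q * 0 + rowDegree B q′ k
      ≡⟨ cong (_+ rowDegree B q′ k) (*-zeroʳ q) ⟩
    rowDegree B q′ k ∎

  columnDegree-block-left : ∀ p′ {j} → j < q → columnDegree (block p q A B) (p + p′) j ≡ columnDegree A p j
  columnDegree-block-left p′ {j} j<q = begin
    columnDegree (block p q A B) (p + p′) j
      ≡⟨ sum-applyUpTo-+ _ p p′ ⟩
    columnDegree (block p q A B) p j + sum (applyUpTo (λ k → ind (block p q A B (p + k) j)) p′)
      ≡⟨ cong₂ _+_ (cong sum (applyUpTo-cong< p (λ i<p → cong ind (block-topLeft i<p j<q))))
                   (sum-applyUpTo-const 0 p′ (λ {k} _ → cong ind (block-bottomLeft k j<q))) ⟩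
    columnDegree A p j + p′ * 0
      ≡⟨ cong (columnDegree A p j +_) (*-zeroʳ p′) ⟩
    columnDegree A p j + 0
      ≡⟨ +-identityʳ _ ⟩
    columnDegree A p j ∎

  columnDegree-block-right : ∀ p′ l → columnDegree (block p q A B) (p + p′) (q + l) ≡ columnDegree B p′ l + p
  columnDegree-block-right p′ l = begin
    columnDegree (block p q A B) (p + p′) (q + l)
      ≡⟨ sum-applyUpTo-+ _ p p′ ⟩
    columnDegree (block p q A B) p (q + l) + sum (applyUpTo (λ k → ind (block p q A B (p + k) (q + l))) p′)
      ≡⟨ cong₂ _+_ (sum-applyUpTo-const 1 p (λ i<p → cong ind (block-topRight l i<p)))
                   (cong sum (applyUpTo-cong< p′ (λ {k} _ → cong ind (block-bottomRight k l)))) ⟩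
    p * 1 + columnDegree B p′ l
      ≡⟨ cong (_+ columnDegree B p′ l) (*-identityʳ p) ⟩
    p + columnDegree B p′ l
      ≡⟨ +-comm p _ ⟩
    columnDegree B p′ l + p ∎

realizedBy-∘ₛ : ∀ {A B u w x y} → RealizedBy A (u , w) → RealizedBy B (x , y) →
                RealizedBy (block (length u) (length w) A B) ((u , w) ∘ₛ (x , y))
realizedBy-∘ₛ {A} {B} {u} {w} {x} {y} (eu , ew) (ex , ey) = primaries , secondaries
  where
  open ≡-Reasoning
  p = length u
  q = length w
  F = block p q A B

  primaries : u ⊕ length y ++ x ≡
              applyUpTo (rowDegree F (length (w ++ y ⊕ p))) (length (u ⊕ length y ++ x))
  primaries = begin
    u ⊕ length y ++ x
      ≡⟨ cong₂ (λ u′ x′ → u′ ⊕ length y ++ x′) eu ex ⟩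
    applyUpTo (rowDegree A q) p ⊕ length y ++ applyUpTo (rowDegree B (length y)) (length x)
      ≡⟨ cong (_++ _) (map-applyUpTo _ _ p) ⟩
    applyUpTo (λ i → rowDegree A q i + length y) p ++ applyUpTo (rowDegree B (length y)) (length x)
      ≡⟨ cong₂ _++_ (applyUpTo-cong< p (rowDegree-block-top {p} {q} A B (length y)))
                    (applyUpTo-cong< (length x) (λ {k} _ → rowDegree-block-bottom {p} {q} A B (length y) k)) ⟨
    applyUpTo (rowDegree F (q + length y)) p ++ applyUpTo (λ k → rowDegree F (q + length y) (p + k)) (length x)
      ≡⟨ applyUpTo-+ _ p (length x) ⟨
    applyUpTo (rowDegree F (q + length y)) (p + length x)
      ≡⟨ cong₂ (λ q′ p′ → applyUpTo (rowDegree F q′) p′)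
               (secondaryCount-∘ₛ (u , w) (x , y)) (primaryCount-∘ₛ (u , w) (x , y)) ⟨
    applyUpTo (rowDegree F (length (w ++ y ⊕ p))) (length (u ⊕ length y ++ x)) ∎

  secondaries : w ++ y ⊕ p ≡
                applyUpTo (columnDegree F (length (u ⊕ length y ++ x))) (length (w ++ y ⊕ p))
  secondaries = begin
    w ++ y ⊕ p
      ≡⟨ cong₂ (λ w′ y′ → w′ ++ y′ ⊕ p) ew ey ⟩
    applyUpTo (columnDegree A p) q ++ applyUpTo (columnDegree B (length x)) (length y) ⊕ p
      ≡⟨ cong (applyUpTo (columnDegree A p) q ++_) (map-applyUpTo _ _ (length y)) ⟩
    applyUpTo (columnDegree A p) q ++ applyUpTo (λ l → columnDegree B (length x) l + p) (length y)
      ≡⟨ cong₂ _++_ (applyUpTo-cong< q (columnDegree-block-left {p} {q} A B (length x)))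
                    (applyUpTo-cong< (length y) (λ {l} _ → columnDegree-block-right {p} {q} A B (length x) l)) ⟨
    applyUpTo (columnDegree F (p + length x)) q ++ applyUpTo (λ l → columnDegree F (p + length x) (q + l)) (length y)
      ≡⟨ applyUpTo-+ _ q (length y) ⟨
    applyUpTo (columnDegree F (p + length x)) (q + length y)
      ≡⟨ cong₂ (λ p′ q′ → applyUpTo (columnDegree F p′) q′)
               (primaryCount-∘ₛ (u , w) (x , y)) (secondaryCount-∘ₛ (u , w) (x , y)) ⟨
    applyUpTo (columnDegree F (length (u ⊕ length y ++ x))) (length (w ++ y ⊕ p)) ∎

linked-++ : ∀ {R : ℕ → ℕ → Set} → Transitive R → ∀ {xs ys} → Linked R xs → Linked R ys →
            All (λ x → All (R x) ys) xs → Linked R (xs ++ ys)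
linked-++ trans lxs lys cross = LinkedP.AllPairs⇒Linked
  (AllPairsP.++⁺ (LinkedP.Linked⇒AllPairs trans lxs) (LinkedP.Linked⇒AllPairs trans lys) cross)

all-≤-⊕ : ∀ u c → All (c ≤_) (u ⊕ c)
all-≤-⊕ u c = AllP.map⁺ (All.universal (m≤n+m c) u)

ordered-∘ₛ : ∀ {u w x y} → Ordered (u , w) → Ordered (x , y) →
             All (_≤ length y) x → All (_≤ length u) w → Ordered ((u , w) ∘ₛ (x , y))
ordered-∘ₛ {u} {w} {x} {y} (u↘ , w↗) (x↘ , y↗) x≤ w≤ =
  linked-++ (flip ≤-trans) (LinkedP.map⁺ (Linked.map (+-monoˡ-≤ _) u↘)) x↘
    (All.map (λ c≤a → All.map (λ b≤c → ≤-trans b≤c c≤a) x≤) (all-≤-⊕ u _)) ,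
  linked-++ ≤-trans w↗ (LinkedP.map⁺ (Linked.map (+-monoˡ-≤ _) y↗))
    (All.map (λ a≤c → All.map (≤-trans a≤c) (all-≤-⊕ y (length u))) w≤)

Valid′ : SBDS → Set
Valid′ s = Ordered s × Realizable s

valid′⇒valid : ∀ {s} → Valid′ s → Valid s
valid′⇒valid (ordered , realizable) = ordered , realizable⇒graphical realizable

valid′-∘ₛ : ∀ {a b} → Valid′ a → Valid′ b → Valid′ (a ∘ₛ b)
valid′-∘ₛ (oa , A , ra) (ob , B , rb) =
  ordered-∘ₛ oa ob (primaryDegrees≤ rb) (secondaryDegrees≤ ra) ,
  _ , realizedBy-∘ₛ ra rb

-- The degree-sum formula and an indecomposability criterion

bdeg≡∑ : ∀ {p q} (E : Fin p → Fin q → Bool) i → bdeg E i ≡ ∑ (λ j → ind (E i j))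
bdeg≡∑ E i = trans (cong sum (map-tabulate id (λ j → ind (E i j)))) (sum-tabulate (λ j → ind (E i j)))

bdeg′≡∑ : ∀ {p q} (E : Fin p → Fin q → Bool) j → bdeg′ E j ≡ ∑ (λ i → ind (E i j))
bdeg′≡∑ E j = trans (cong sum (map-tabulate id (λ i → ind (E i j)))) (sum-tabulate (λ i → ind (E i j)))

sum≡∑-lookup : ∀ xs → sum xs ≡ ∑ (lookup xs)
sum≡∑-lookup xs = trans (cong sum (sym (tabulate-lookup xs))) (sum-tabulate (lookup xs))

degree-sum : ∀ {u w} → Graphical (u , w) → sum u ≡ sum w
degree-sum {u} {w} (E , deg-u , deg-w) = begin
  sum u                                    ≡⟨ sum≡∑-lookup u ⟩
  ∑ (lookup u)                             ≡⟨ sum-cong-≗ (λ i → trans (sym (deg-u i)) (bdeg≡∑ E i)) ⟩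
  ∑ (λ i → ∑ (λ j → ind (E i j)))          ≡⟨ ∑-comm (λ i j → ind (E i j)) ⟩
  ∑ (λ j → ∑ (λ i → ind (E i j)))          ≡⟨ sum-cong-≗ (λ j → trans (sym (bdeg′≡∑ E j)) (deg-w j)) ⟩
  ∑ (lookup w)                             ≡⟨ sum≡∑-lookup w ⟨
  sum w                                    ∎
  where open ≡-Reasoning

-- A split s = a ∘ₛ b with a of shape (i , j) forces this: the first i primary degrees count the
-- edges of a, i.e. the first j secondary degrees, plus the i · (|S| - j) edges added by ∘ₛ.
BalancedAt : SBDS → ℕ → ℕ → Set
BalancedAt (P , S) i j = sum (take i P) ≡ sum (take j S) + i * (length S ∸ j)

balancedAt? : ∀ s i j → Dec (BalancedAt s i j)
balancedAt? (P , S) i j = sum (take i P) ≟ sum (take j S) + i * (length S ∸ j)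

balancedAt-∘ₛ : ∀ {u w} x y → Graphical (u , w) → BalancedAt ((u , w) ∘ₛ (x , y)) (length u) (length w)
balancedAt-∘ₛ {u} {w} x y g = begin
  sum (take (length u) (u ⊕ length y ++ x))
    ≡⟨ cong (λ n → sum (take n (u ⊕ length y ++ x))) (length-⊕ u _) ⟨
  sum (take (length (u ⊕ length y)) (u ⊕ length y ++ x))
    ≡⟨ cong sum (take-length-++ (u ⊕ length y) x) ⟩
  sum (u ⊕ length y)
    ≡⟨ sum-⊕ u _ ⟩
  sum u + length u * length y
    ≡⟨ cong₂ (λ s n → s + length u * n) (degree-sum {u} {w} g) (sym secondaries-after-w) ⟩
  sum w + length u * (length (w ++ y ⊕ length u) ∸ length w)
    ≡⟨ cong (λ v → sum v + length u * (length (w ++ y ⊕ length u) ∸ length w)) (take-length-++ w _) ⟨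
  sum (take (length w) (w ++ y ⊕ length u)) + length u * (length (w ++ y ⊕ length u) ∸ length w) ∎
  where
  open ≡-Reasoning
  secondaries-after-w : length (w ++ y ⊕ length u) ∸ length w ≡ length y
  secondaries-after-w = trans (cong (_∸ length w) (secondaryCount-∘ₛ (u , w) (x , y))) (m+n∸m≡n (length w) _)

NoProperBalancedSplit : SBDS → Set
NoProperBalancedSplit s =
  ∀ {i} → i < suc (length (primary s)) → ∀ {j} → j < suc (length (secondary s)) →
  BalancedAt s i j → i + j ≡ 0 ⊎ i + j ≡ vertices s

noProperBalancedSplit? : ∀ s → Dec (NoProperBalancedSplit s)
noProperBalancedSplit? s@(P , S) =
  allUpTo? (λ i → allUpTo? (λ j → balancedAt? s i j →-dec (i + j ≟ 0 ⊎-dec i + j ≟ vertices s))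
    (suc (length S))) (suc (length P))

noProperBalancedSplit⇒indecomposable : ∀ {s} → NoProperBalancedSplit s → Indecomposable s
noProperBalancedSplit⇒indecomposable noSplit (a@(u , w) , b@(x , y) , (_ , ga) , _ , 1≤a , 1≤b , refl)
  with noSplit {length u} (s≤s (≤-trans (m≤m+n _ _) (≤-reflexive (sym (primaryCount-∘ₛ a b)))))
               {length w} (s≤s (≤-trans (m≤m+n _ _) (≤-reflexive (sym (secondaryCount-∘ₛ a b)))))
               (balancedAt-∘ₛ {u} {w} x y ga)
... | inj₁ a-empty = <⇒≢ 1≤a (sym a-empty)
... | inj₂ b-empty = <⇒≢ (m<m+n (vertices a) 1≤b) (trans b-empty (vertices-∘ₛ a b))

-- In ℓ ∘ₛ s the primary degrees of ℓ are shifted by the secondary count of s, which the total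
-- secondary count determines; the secondary degrees of ℓ are kept, and the later ones are at least
-- the primary count of ℓ.
data Apart : SBDS → SBDS → Set where
  primary-differs   : ∀ {u w u′ w′} i → i < length u → i < length u′ →
                      length w′ + at u i ≢ length w + at u′ i → Apart (u , w) (u′ , w′)
  secondary-differs : ∀ {u w u′ w′} j → j < length w → j < length w′ →
                      at w j ≢ at w′ j → Apart (u , w) (u′ , w′)
  secondary-small   : ∀ {u w u′ w′} j → length w ≤ j → j < length w′ →
                      at w′ j < length u → Apart (u , w) (u′ , w′)
  swap              : ∀ {ℓ ℓ′} → Apart ℓ′ ℓ → Apart ℓ ℓ′

apart-∘ₛ : ∀ {ℓ ℓ′} → Apart ℓ ℓ′ → ∀ s s′ → ℓ ∘ₛ s ≢ ℓ′ ∘ₛ s′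
apart-∘ₛ {u , w} {u′ , w′} (primary-differs i i<u i<u′ differs) (x , y) (x′ , y′) eq =
  differs (exchange-cancel (at u i) (at u′ i) (length y) (length y′) (length w) (length w′)
    (begin
      at u i + length y                   ≡⟨ at-⊕ u _ i<u ⟨
      at (u ⊕ length y) i                 ≡⟨ at-++ˡ (u ⊕ length y) x (subst (i <_) (sym (length-⊕ u _)) i<u) ⟨
      at (u ⊕ length y ++ x) i            ≡⟨ cong (λ P → at P i) (cong proj₁ eq) ⟩
      at (u′ ⊕ length y′ ++ x′) i         ≡⟨ at-++ˡ (u′ ⊕ length y′) x′ (subst (i <_) (sym (length-⊕ u′ _)) i<u′) ⟩
      at (u′ ⊕ length y′) i               ≡⟨ at-⊕ u′ _ i<u′ ⟩
      at u′ i + length y′                 ∎)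
    (begin
      length w + length y                 ≡⟨ secondaryCount-∘ₛ (u , w) (x , y) ⟨
      length (w ++ y ⊕ length u)          ≡⟨ cong (length ∘ proj₂) eq ⟩
      length (w′ ++ y′ ⊕ length u′)       ≡⟨ secondaryCount-∘ₛ (u′ , w′) (x′ , y′) ⟩
      length w′ + length y′               ∎))
  where open ≡-Reasoning
apart-∘ₛ {u , w} {u′ , w′} (secondary-differs j j<w j<w′ differs) (x , y) (x′ , y′) eq =
  differs (begin
    at w j                      ≡⟨ at-++ˡ w _ j<w ⟨
    at (w ++ y ⊕ length u) j    ≡⟨ cong (λ S → at S j) (cong proj₂ eq) ⟩
    at (w′ ++ y′ ⊕ length u′) j ≡⟨ at-++ˡ w′ _ j<w′ ⟩
    at w′ j                     ∎)
  where open ≡-Reasoning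
apart-∘ₛ {u , w} {u′ , w′} (secondary-small j w≤j j<w′ small) (x , y) (x′ , y′) eq =
  <⇒≱ small (≤-trans (at-++-⊕-≥ w y (length u) w≤j j<S)
    (≤-reflexive (trans (cong (λ S → at S j) (cong proj₂ eq)) (at-++ˡ w′ _ j<w′))))
  where
  j<S : j < length (w ++ y ⊕ length u)
  j<S = subst (j <_) (cong (length ∘ proj₂) (sym eq))
          (≤-trans j<w′ (≤-trans (m≤m+n _ _) (≤-reflexive (sym (secondaryCount-∘ₛ (u′ , w′) (x′ , y′))))))
apart-∘ₛ (swap apart) s s′ eq = apart-∘ₛ apart s′ s (sym eq)

-- The letters

Adjacency : Set
Adjacency = List (List ℕ)

adjacent : Adjacency → ℕ → ℕ → Bool
adjacent []      _       _ = false
adjacent (N ∷ A) zero    j = any (_≡ᵇ j) N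
adjacent (N ∷ A) (suc i) j = adjacent A i j

-- Each letter with a realization, listing the secondary neighbours of every primary vertex.
letterTable : List (SBDS × Adjacency)
letterTable =
  ((0 ∷ [] , []) , [] ∷ []) ∷
  (([] , 0 ∷ []) , []) ∷
  ((1 ∷ 1 ∷ [] , 1 ∷ 1 ∷ []) , (0 ∷ []) ∷ (1 ∷ []) ∷ []) ∷
  ((2 ∷ 1 ∷ [] , 1 ∷ 1 ∷ 1 ∷ []) , (0 ∷ 1 ∷ []) ∷ (2 ∷ []) ∷ []) ∷
  ((1 ∷ 1 ∷ 1 ∷ [] , 1 ∷ 2 ∷ []) , (1 ∷ []) ∷ (0 ∷ []) ∷ (1 ∷ []) ∷ []) ∷
  ((3 ∷ 1 ∷ [] , 1 ∷ 1 ∷ 1 ∷ 1 ∷ []) , (0 ∷ 1 ∷ 2 ∷ []) ∷ (3 ∷ []) ∷ []) ∷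
  ((2 ∷ 2 ∷ [] , 1 ∷ 1 ∷ 1 ∷ 1 ∷ []) , (0 ∷ 1 ∷ []) ∷ (2 ∷ 3 ∷ []) ∷ []) ∷
  ((2 ∷ 2 ∷ 2 ∷ [] , 2 ∷ 2 ∷ 2 ∷ []) , (0 ∷ 1 ∷ []) ∷ (0 ∷ 2 ∷ []) ∷ (1 ∷ 2 ∷ []) ∷ []) ∷
  ((1 ∷ 1 ∷ 1 ∷ 1 ∷ [] , 1 ∷ 3 ∷ []) , (1 ∷ []) ∷ (1 ∷ []) ∷ (0 ∷ []) ∷ (1 ∷ []) ∷ []) ∷
  ((4 ∷ 1 ∷ [] , 1 ∷ 1 ∷ 1 ∷ 1 ∷ 1 ∷ []) , (0 ∷ 1 ∷ 2 ∷ 3 ∷ []) ∷ (4 ∷ []) ∷ []) ∷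
  ((3 ∷ 2 ∷ [] , 1 ∷ 1 ∷ 1 ∷ 1 ∷ 1 ∷ []) , (0 ∷ 1 ∷ 2 ∷ []) ∷ (3 ∷ 4 ∷ []) ∷ []) ∷
  ((3 ∷ 2 ∷ 2 ∷ [] , 1 ∷ 2 ∷ 2 ∷ 2 ∷ []) , (1 ∷ 2 ∷ 3 ∷ []) ∷ (0 ∷ 1 ∷ []) ∷ (2 ∷ 3 ∷ []) ∷ []) ∷
  ((2 ∷ 2 ∷ 2 ∷ 2 ∷ [] , 2 ∷ 3 ∷ 3 ∷ []) , (1 ∷ 2 ∷ []) ∷ (0 ∷ 1 ∷ []) ∷ (0 ∷ 2 ∷ []) ∷ (1 ∷ 2 ∷ []) ∷ []) ∷
  ((1 ∷ 1 ∷ 1 ∷ 1 ∷ 1 ∷ [] , 1 ∷ 4 ∷ []) , (1 ∷ []) ∷ (1 ∷ []) ∷ (1 ∷ []) ∷ (0 ∷ []) ∷ (1 ∷ []) ∷ []) ∷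
  ((5 ∷ 1 ∷ [] , 1 ∷ 1 ∷ 1 ∷ 1 ∷ 1 ∷ 1 ∷ []) , (0 ∷ 1 ∷ 2 ∷ 3 ∷ 4 ∷ []) ∷ (5 ∷ []) ∷ []) ∷
  ((4 ∷ 2 ∷ [] , 1 ∷ 1 ∷ 1 ∷ 1 ∷ 1 ∷ 1 ∷ []) , (0 ∷ 1 ∷ 2 ∷ 3 ∷ []) ∷ (4 ∷ 5 ∷ []) ∷ []) ∷
  ((3 ∷ 3 ∷ [] , 1 ∷ 1 ∷ 1 ∷ 1 ∷ 1 ∷ 1 ∷ []) , (0 ∷ 1 ∷ 2 ∷ []) ∷ (3 ∷ 4 ∷ 5 ∷ []) ∷ []) ∷
  ((3 ∷ 3 ∷ 3 ∷ [] , 1 ∷ 2 ∷ 2 ∷ 2 ∷ 2 ∷ []) , (1 ∷ 2 ∷ 3 ∷ []) ∷ (0 ∷ 1 ∷ 4 ∷ []) ∷ (2 ∷ 3 ∷ 4 ∷ []) ∷ []) ∷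
  ((4 ∷ 3 ∷ 3 ∷ [] , 2 ∷ 2 ∷ 2 ∷ 2 ∷ 2 ∷ []) ,
    (0 ∷ 1 ∷ 2 ∷ 3 ∷ []) ∷ (0 ∷ 1 ∷ 4 ∷ []) ∷ (2 ∷ 3 ∷ 4 ∷ []) ∷ []) ∷
  ((2 ∷ 2 ∷ 2 ∷ 2 ∷ [] , 2 ∷ 2 ∷ 2 ∷ 2 ∷ []) , (0 ∷ 1 ∷ []) ∷ (2 ∷ 3 ∷ []) ∷ (0 ∷ 1 ∷ []) ∷ (2 ∷ 3 ∷ []) ∷ []) ∷
  ((3 ∷ 3 ∷ 3 ∷ 3 ∷ [] , 3 ∷ 3 ∷ 3 ∷ 3 ∷ []) ,
    (0 ∷ 1 ∷ 2 ∷ []) ∷ (0 ∷ 1 ∷ 3 ∷ []) ∷ (0 ∷ 2 ∷ 3 ∷ []) ∷ (1 ∷ 2 ∷ 3 ∷ []) ∷ []) ∷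
  ((2 ∷ 2 ∷ 2 ∷ 2 ∷ 2 ∷ [] , 2 ∷ 4 ∷ 4 ∷ []) ,
    (1 ∷ 2 ∷ []) ∷ (1 ∷ 2 ∷ []) ∷ (0 ∷ 1 ∷ []) ∷ (0 ∷ 2 ∷ []) ∷ (1 ∷ 2 ∷ []) ∷ []) ∷
  ((1 ∷ 1 ∷ 1 ∷ 1 ∷ 1 ∷ 1 ∷ [] , 1 ∷ 5 ∷ []) ,
    (1 ∷ []) ∷ (1 ∷ []) ∷ (1 ∷ []) ∷ (1 ∷ []) ∷ (0 ∷ []) ∷ (1 ∷ []) ∷ []) ∷
  []

letters : List SBDS
letters = map proj₁ letterTable

record IsLetter (ℓ : SBDS) : Set where
  field
    valid          : Valid′ ℓ
    indecomposable : Indecomposable ℓ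
    nonempty       : 1 ≤ vertices ℓ
    small          : SmallComponent ℓ
    size≤8         : vertices ℓ ≤ 8

Certified : SBDS × Adjacency → Set
Certified (ℓ , A) = Ordered ℓ × RealizedBy (adjacent A) ℓ × NoProperBalancedSplit ℓ ×
                    1 ≤ vertices ℓ × SmallComponent ℓ × vertices ℓ ≤ 8

certified? : ∀ e → Dec (Certified e)
certified? (ℓ@(u , w) , A) =
  (linked? _≥?_ u ×-dec linked? _≤?_ w) ×-dec
  (≡-dec _≟_ u _ ×-dec ≡-dec _≟_ w _) ×-dec
  noProperBalancedSplit? ℓ ×-dec
  1 ≤? vertices ℓ ×-dec (length u ≤? 6 ×-dec length w ≤? 6) ×-dec vertices ℓ ≤? 8

certified⇒isLetter : ∀ {e} → Certified e → IsLetter (proj₁ e)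
certified⇒isLetter (ordered , realized , noSplit , nonempty , small , size≤8) = record
  { valid          = ordered , _ , realized
  ; indecomposable = noProperBalancedSplit⇒indecomposable noSplit
  ; nonempty       = nonempty
  ; small          = small
  ; size≤8         = size≤8
  }

letters-isLetter : All IsLetter letters
letters-isLetter =
  AllP.map⁺ (All.map (λ {e} → certified⇒isLetter {e}) (from-yes (All.all? certified? letterTable)))

letter-fits : ∀ {ℓ a b} → 6 ≤ a → 6 ≤ b → IsLetter ℓ → length (primary ℓ) ≤ a × length (secondary ℓ) ≤ b
letter-fits 6≤a 6≤b isLetter =
  ≤-trans (proj₁ (IsLetter.small isLetter)) 6≤a , ≤-trans (proj₂ (IsLetter.small isLetter)) 6≤b

apartAt? : ∀ ℓ ℓ′ → ℕ → Maybe (Apart ℓ ℓ′)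
apartAt? (u , w) (u′ , w′) k =
  Maybe.map (λ (a , b , c) → primary-differs k a b c)
    (dec⇒maybe (k <? length u ×-dec k <? length u′ ×-dec ¬? (length w′ + at u k ≟ length w + at u′ k))) <∣>
  Maybe.map (λ (a , b , c) → secondary-differs k a b c)
    (dec⇒maybe (k <? length w ×-dec k <? length w′ ×-dec ¬? (at w k ≟ at w′ k))) <∣>
  Maybe.map (λ (a , b , c) → secondary-small k a b c)
    (dec⇒maybe (length w ≤? k ×-dec k <? length w′ ×-dec at w′ k <? length u))

apart? : ∀ ℓ ℓ′ → Maybe (Apart ℓ ℓ′)
apart? ℓ ℓ′ =
  foldr (λ k found → apartAt? ℓ ℓ′ k <∣> Maybe.map swap (apartAt? ℓ′ ℓ k) <∣> found) nothing (upTo 6)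

letters-apart : AllPairs Apart letters
letters-apart = AllPairs.map (to-witness-T _)
  (from-yes (allPairs? (λ ℓ ℓ′ → T? (is-just (apart? ℓ ℓ′))) letters))

-- Words in the letters

fits? : ∀ ℓ a b → Dec (length (primary ℓ) ≤ a × length (secondary ℓ) ≤ b)
fits? ℓ a b = length (primary ℓ) ≤? a ×-dec length (secondary ℓ) ≤? b

suffixes : (ℕ → ℕ → List SBDS) → ℕ → ℕ → SBDS → List SBDS
suffixes W a b ℓ with fits? ℓ a b
... | yes _ = W (a ∸ length (primary ℓ)) (b ∸ length (secondary ℓ))
... | no  _ = []

prefixedBy : SBDS → (ℕ → ℕ → List SBDS) → ℕ → ℕ → List SBDS
prefixedBy ℓ W a b = map (ℓ ∘ₛ_) (suffixes W a b ℓ)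

emptyWord : ℕ → ℕ → List SBDS
emptyWord zero    zero    = ([] , []) ∷ []
emptyWord zero    (suc _) = []
emptyWord (suc _) _       = []

-- The fuel f bounds the number of letters; f > a + b suffices, as every letter has a vertex.
words : ℕ → ℕ → ℕ → List SBDS
words zero    a b = []
words (suc f) a b = emptyWord a b ++ concatMap (λ ℓ → prefixedBy ℓ (words f) a b) letters

Counted′ : ℕ → ℕ → SBDS → Set
Counted′ a b s = length (primary s) ≡ a × length (secondary s) ≡ b × Valid′ s × OnlySmallComponents s

counted′-∘ₛ : ∀ {ℓ a b s} → IsLetter ℓ → length (primary ℓ) ≤ a → length (secondary ℓ) ≤ b →
              Counted′ (a ∸ length (primary ℓ)) (b ∸ length (secondary ℓ)) s → Counted′ a b (ℓ ∘ₛ s)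
counted′-∘ₛ {ℓ} {s = s} isLetter p≤a q≤b (p′ , q′ , valid , cs , components , s≡cs) =
  trans (primaryCount-∘ₛ ℓ s) (trans (cong (length (primary ℓ) +_) p′) (m+[n∸m]≡n p≤a)) ,
  trans (secondaryCount-∘ₛ ℓ s) (trans (cong (length (secondary ℓ) +_) q′) (m+[n∸m]≡n q≤b)) ,
  valid′-∘ₛ (IsLetter.valid isLetter) valid ,
  ℓ ∷ cs ,
  (valid′⇒valid (IsLetter.valid isLetter) , IsLetter.indecomposable isLetter ,
   IsLetter.nonempty isLetter , IsLetter.small isLetter) ∷ components ,
  cong (ℓ ∘ₛ_) s≡cs

emptyWord-counted′ : ∀ a b → All (Counted′ a b) (emptyWord a b)
emptyWord-counted′ zero    zero    =
  (refl , refl , ((Linked.[] , Linked.[]) , (λ _ _ → false) , refl , refl) , [] , [] , refl) ∷ []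
emptyWord-counted′ zero    (suc _) = []
emptyWord-counted′ (suc _) _       = []

words-counted′ : ∀ f a b → All (Counted′ a b) (words f a b)
words-counted′ zero    a b = []
words-counted′ (suc f) a b =
  AllP.++⁺ (emptyWord-counted′ a b) (AllP.concat⁺ (AllP.map⁺ (All.map prefixed letters-isLetter)))
  where
  prefixed : ∀ {ℓ} → IsLetter ℓ → All (Counted′ a b) (prefixedBy ℓ (words f) a b)
  prefixed {ℓ} isLetter with fits? ℓ a b
  ... | yes (p≤a , q≤b) = AllP.map⁺ (All.map (counted′-∘ₛ isLetter p≤a q≤b) (words-counted′ f _ _))
  ... | no  _           = []

all-disjoint : ∀ {A : Set} {P : A → Set} {xs ys} → All P xs → All (¬_ ∘ P) ys → Disjoint xs ys
all-disjoint pxs ¬pys (v∈xs , v∈ys) = All.lookup ¬pys v∈ys (All.lookup pxs v∈xs)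

apart-disjoint : ∀ {ℓ ℓ′} → Apart ℓ ℓ′ → ∀ X Y → Disjoint (map (ℓ ∘ₛ_) X) (map (ℓ′ ∘ₛ_) Y)
apart-disjoint {ℓ} {ℓ′} apart X Y (v∈X , v∈Y) with ∈-map⁻ (ℓ ∘ₛ_) v∈X | ∈-map⁻ (ℓ′ ∘ₛ_) v∈Y
... | s , _ , refl | s′ , _ , eq = apart-∘ₛ apart s s′ eq

prefixed-nonempty : ∀ {ℓ} → IsLetter ℓ → ∀ X → All (λ v → ¬ vertices v ≡ 0) (map (ℓ ∘ₛ_) X)
prefixed-nonempty {ℓ} isLetter X = AllP.map⁺ (All.universal nonempty X)
  where
  nonempty : ∀ s → ¬ vertices (ℓ ∘ₛ s) ≡ 0
  nonempty s empty = <⇒≢ (IsLetter.nonempty isLetter)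
    (sym (m+n≡0⇒m≡0 (vertices ℓ) (trans (sym (vertices-∘ₛ ℓ s)) empty)))

emptyWord-empty : ∀ a b → All (λ v → vertices v ≡ 0) (emptyWord a b)
emptyWord-empty zero    zero    = refl ∷ []
emptyWord-empty zero    (suc _) = []
emptyWord-empty (suc _) _       = []

emptyWord-unique : ∀ a b → Unique (emptyWord a b)
emptyWord-unique zero    zero    = [] AllPairs.∷ AllPairs.[]
emptyWord-unique zero    (suc _) = AllPairs.[]
emptyWord-unique (suc _) _       = AllPairs.[]

words-unique : ∀ f a b → Unique (words f a b)
words-unique zero    a b = AllPairs.[]
words-unique (suc f) a b =
  UniqueP.++⁺ (emptyWord-unique a b)
    (UniqueP.concat⁺ (AllP.map⁺ (All.universal prefixed-unique letters))
      (AllPairsP.map⁺ {f = prefixed} (AllPairs.map (λ apart {v} → apart-disjoint apart _ _ {v}) letters-apart)))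
    (all-disjoint (emptyWord-empty a b) (AllP.concat⁺ (AllP.map⁺ {f = prefixed}
      (All.map (λ isLetter → prefixed-nonempty isLetter _) letters-isLetter))))
  where
  prefixed : SBDS → List SBDS
  prefixed ℓ = prefixedBy ℓ (words f) a b
  suffixes-unique : ∀ ℓ → Unique (suffixes (words f) a b ℓ)
  suffixes-unique ℓ with fits? ℓ a b
  ... | yes _ = words-unique f _ _
  ... | no  _ = AllPairs.[]
  prefixed-unique : ∀ ℓ → Unique (prefixed ℓ)
  prefixed-unique ℓ = UniqueP.map⁺ (∘ₛ-cancelˡ ℓ) (suffixes-unique ℓ)

counted′⇒counted : ∀ {n s} → Counted′ n n s → Counted n s
counted′⇒counted (p , q , valid , components) = p , q , valid′⇒valid valid , components

count : ℕ → ℕ → ℕ → ℕ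
count f a b = length (words f a b)

prefixed≤count : ∀ f a b → length (concatMap (λ ℓ → prefixedBy ℓ (words f) a b) letters) ≤ count (suc f) a b
prefixed≤count f a b = ≤-trans (m≤n+m _ _) (≤-reflexive (sym (length-++ (emptyWord a b))))

suffixes≤count : ∀ f a b {ℓ} → ℓ ∈ letters → length (suffixes (words f) a b ℓ) ≤ count (suc f) a b
suffixes≤count f a b {ℓ} ℓ∈letters = begin
  length (suffixes (words f) a b ℓ)  ≡⟨ length-map (ℓ ∘ₛ_) (suffixes (words f) a b ℓ) ⟨
  length (prefixedBy ℓ (words f) a b) ≤⟨ length-≤-concatMap (λ ℓ → prefixedBy ℓ (words f) a b) ℓ∈letters ⟩
  length (concatMap (λ ℓ → prefixedBy ℓ (words f) a b) letters) ≤⟨ prefixed≤count f a b ⟩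
  count (suc f) a b ∎
  where open ≤-Reasoning

-- The first two letters are a single primary and a single secondary vertex.
count-pos : ∀ f a b → a + b < f → 1 ≤ count f a b
count-pos (suc f) zero    zero    _           = s≤s z≤n
count-pos (suc f) (suc a) b       (s≤s a+b<f) =
  ≤-trans (count-pos f a b a+b<f) (suffixes≤count f (suc a) b (here refl))
count-pos (suc f) zero    (suc b) (s≤s b<f)   =
  ≤-trans (count-pos f 0 b b<f) (suffixes≤count f 0 (suc b) (there (here refl)))

count-step : ∀ f a b → 6 ≤ a → 6 ≤ b →
  sum (map (λ ℓ → count f (a ∸ length (primary ℓ)) (b ∸ length (secondary ℓ))) letters) ≤ count (suc f) a b
count-step f a b 6≤a 6≤b = begin
  sum (map (λ ℓ → count f (a ∸ length (primary ℓ)) (b ∸ length (secondary ℓ))) letters)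
    ≤⟨ sum-map-mono (All.map (≤-reflexive ∘ all-fit) letters-isLetter) ⟩
  sum (map (length ∘ prefixed) letters)
    ≡⟨ length-concatMap prefixed letters ⟨
  length (concatMap prefixed letters)
    ≤⟨ prefixed≤count f a b ⟩
  count (suc f) a b ∎
  where
  open ≤-Reasoning
  prefixed : SBDS → List SBDS
  prefixed ℓ = prefixedBy ℓ (words f) a b
  all-fit : ∀ {ℓ} → IsLetter ℓ →
            count f (a ∸ length (primary ℓ)) (b ∸ length (secondary ℓ)) ≡ length (prefixed ℓ)
  all-fit {ℓ} isLetter with fits? ℓ a b
  ... | yes _ = sym (length-map (ℓ ∘ₛ_) (words f _ _))
  ... | no ¬fit = contradiction (letter-fits 6≤a 6≤b isLetter) ¬fit

-- A potential for the growth rate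

potentialTable : List ℕ
potentialTable = 0 ∷ 0 ∷ 0 ∷ 0 ∷ 0 ∷ 0 ∷ 233 ∷ 435 ∷ 608 ∷ 751 ∷ 863 ∷ 941 ∷ 987 ∷ 1000 ∷
                 983 ∷ 937 ∷ 867 ∷ 775 ∷ 666 ∷ 545 ∷ 415 ∷ 281 ∷ 144 ∷ []

potential : ℕ → ℕ
potential = at potentialTable

-- The potential of a sequence with a primary and b secondary vertices is indexed by
-- a - b + 14; it vanishes unless |a - b| ≤ 8, so the truncated subtraction is harmless.
weight : ℕ → ℕ → ℕ
weight a b = potential (a + 14 ∸ b)

letterFactor : SBDS → ℕ
letterFactor ℓ = 2234 ^ (8 ∸ vertices ℓ) * 1000 ^ vertices ℓ

transferTerm : ℕ → SBDS → ℕ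
transferTerm k ℓ = potential (k + length (secondary ℓ) ∸ length (primary ℓ)) * letterFactor ℓ

transfer : ℕ → ℕ
transfer k = sum (map (transferTerm k) letters)

-- With ρ = 2234/1000 this says potential k ≤ ∑ℓ potential (k + qℓ - pℓ) · ρ^(-|ℓ|), scaled by 2234^8:
-- the potential is a subsolution of the transfer equation of the letters at growth ρ per vertex.
potential-subsolution : ∀ k → potential k * 2234 ^ 8 ≤ transfer k
potential-subsolution k with k <? 23
... | yes k<23 = from-yes (allUpTo? (λ k → potential k * 2234 ^ 8 ≤? transfer k) 23) k<23
... | no  k≮23 = subst (λ v → v * 2234 ^ 8 ≤ transfer k) (sym (at-≥ potentialTable (≮⇒≥ k≮23))) z≤n

potential≤1000 : ∀ k → potential k ≤ 1000
potential≤1000 k with k <? 23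
... | yes k<23 = from-yes (allUpTo? (λ k → potential k ≤? 1000) 23) k<23
... | no  k≮23 = subst (_≤ 1000) (sym (at-≥ potentialTable (≮⇒≥ k≮23))) z≤n

potential-support : ∀ k → potential k ≢ 0 → 6 ≤ k × k ≤ 22
potential-support k nonzero with 6 ≤? k | k <? 23
... | yes 6≤k | yes k<23 = 6≤k , ≤-pred k<23
... | no  6≰k | _        = contradiction (from-yes (allUpTo? (λ k → potential k ≟ 0) 6) (≰⇒> 6≰k)) nonzero
... | _       | no  k≮23 = contradiction (at-≥ potentialTable (≮⇒≥ k≮23)) nonzero

band⇒large : ∀ a b → 6 ≤ a + 14 ∸ b → a + 14 ∸ b ≤ 22 → 20 ≤ a + b → 6 ≤ a × 6 ≤ b × b ≤ a + 14
band⇒large a b 6≤k k≤22 20≤a+b =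
  6≤ b≤a+8 20≤a+b , 6≤ a≤b+8 (subst (20 ≤_) (+-comm a b) 20≤a+b) , b≤a+14
  where
  b≤a+14 : b ≤ a + 14
  b≤a+14 = <⇒≤ (m∸n≢0⇒n<m (λ k≡0 → <⇒≢ (≤-trans (s≤s z≤n) 6≤k) (sym k≡0)))
  b+k≡a+14 : b + (a + 14 ∸ b) ≡ a + 14
  b+k≡a+14 = m+[n∸m]≡n b≤a+14
  b≤a+8 : b ≤ a + 8
  b≤a+8 = +-cancelʳ-≤ 6 b (a + 8)
    (≤-trans (+-monoʳ-≤ b 6≤k) (≤-reflexive (trans b+k≡a+14 (sym (+-assoc a 8 6)))))
  a≤b+8 : a ≤ b + 8
  a≤b+8 = +-cancelʳ-≤ 14 a (b + 8)
    (≤-trans (≤-reflexive (sym b+k≡a+14)) (≤-trans (+-monoʳ-≤ b k≤22) (≤-reflexive (sym (+-assoc b 8 14)))))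
  6≤ : ∀ {m n} → n ≤ m + 8 → 20 ≤ m + n → 6 ≤ m
  6≤ {m} {n} n≤m+8 20≤m+n with 6 ≤? m
  ... | yes 6≤m = 6≤m
  ... | no  6≰m = contradiction (≤-trans 20≤m+n (+-mono-≤ m≤5 (≤-trans n≤m+8 (+-monoˡ-≤ 8 m≤5))))
                                (λ 20≤18 → ≤⇒≯ 20≤18 (n≤1+n 19))
    where
    m≤5 : m ≤ 5
    m≤5 = ≤-pred (≰⇒> 6≰m)

weight-∸ : ∀ {a b p q} → p ≤ a → q ≤ b → b ≤ a + 14 → weight (a ∸ p) (b ∸ q) ≡ potential (a + 14 ∸ b + q ∸ p)
weight-∸ {a} {b} {p} {q} p≤a q≤b b≤a+14 =
  cong potential (∸-exchange ((a ∸ p) + 14) (b ∸ q) (a + 14 ∸ b + q) p (begin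
    (a ∸ p) + 14 + p                ≡⟨ xy∙z≈xz∙y (a ∸ p) 14 p ⟩
    (a ∸ p) + p + 14                ≡⟨ cong (_+ 14) (m∸n+n≡m p≤a) ⟩
    a + 14                          ≡⟨ m+[n∸m]≡n b≤a+14 ⟨
    b + (a + 14 ∸ b)                ≡⟨ cong (_+ (a + 14 ∸ b)) (m∸n+n≡m q≤b) ⟨
    (b ∸ q) + q + (a + 14 ∸ b)      ≡⟨ xy∙z≈x∙zy (b ∸ q) q _ ⟩
    (b ∸ q) + (a + 14 ∸ b + q)      ∎))
  where open ≡-Reasoning

-- Exponential growth

-- The constant d stays a variable: with the literal 1000 * 2234 ^ 20 in its place, conversion
-- checking would unfold products d * x by unary recursion on d.
Growth : ℕ → ℕ → ℕ → ℕ → Set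
Growth d f a b = weight a b * 2234 ^ (a + b) ≤ d * (1000 ^ (a + b) * count f a b)

growth-small : ∀ {d} f a b → 1000 * 2234 ^ 20 ≤ d → a + b < 20 → 1 ≤ count f a b → Growth d f a b
growth-small {d} f a b d-large small nonempty = begin
  weight a b * 2234 ^ (a + b)        ≤⟨ *-mono-≤ (potential≤1000 (a + 14 ∸ b)) (^-monoʳ-≤ 2234 (<⇒≤ small)) ⟩
  1000 * 2234 ^ 20                   ≤⟨ d-large ⟩
  d                                  ≡⟨ *-identityʳ d ⟨
  d * 1                              ≤⟨ *-monoʳ-≤ d (*-mono-≤ (m^n>0 1000 (a + b)) nonempty) ⟩
  d * (1000 ^ (a + b) * count f a b) ∎
  where open ≤-Reasoning

∸-sizes : ∀ {a b p q} → p ≤ a → q ≤ b → (a ∸ p) + (b ∸ q) + (p + q) ≡ a + b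
∸-sizes {a} {b} {p} {q} p≤a q≤b =
  trans (interchange (a ∸ p) (b ∸ q) p q) (cong₂ _+_ (m∸n+n≡m p≤a) (m∸n+n≡m q≤b))

growth-letter : ∀ {d f a b ℓ} → IsLetter ℓ → length (primary ℓ) ≤ a → length (secondary ℓ) ≤ b →
  b ≤ a + 14 → 8 ≤ a + b → Growth d f (a ∸ length (primary ℓ)) (b ∸ length (secondary ℓ)) →
  transferTerm (a + 14 ∸ b) ℓ * 2234 ^ (a + b ∸ 8)
    ≤ d * (1000 ^ (a + b) * count f (a ∸ length (primary ℓ)) (b ∸ length (secondary ℓ)))
growth-letter {d} {f} {a} {b} {ℓ} isLetter p≤a q≤b b≤a+14 8≤a+b growth = begin
  potential k * (2234 ^ (8 ∸ s) * 1000 ^ s) * 2234 ^ (a + b ∸ 8)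
    ≡⟨ rearrange (potential k) (2234 ^ (8 ∸ s)) (1000 ^ s) (2234 ^ (a + b ∸ 8)) ⟩
  potential k * (2234 ^ (8 ∸ s) * 2234 ^ (a + b ∸ 8)) * 1000 ^ s
    ≡⟨ cong (λ x → potential k * x * 1000 ^ s)
            (trans (sym (^-distribˡ-+-* 2234 (8 ∸ s) (a + b ∸ 8))) (cong (2234 ^_) exponent)) ⟩
  potential k * 2234 ^ E * 1000 ^ s
    ≡⟨ cong (λ v → v * 2234 ^ E * 1000 ^ s) (weight-∸ p≤a q≤b b≤a+14) ⟨
  weight a′ b′ * 2234 ^ E * 1000 ^ s
    ≤⟨ *-monoˡ-≤ (1000 ^ s) growth ⟩
  d * (1000 ^ E * count f a′ b′) * 1000 ^ s
    ≡⟨ rearrange′ d (1000 ^ E) (count f a′ b′) (1000 ^ s) ⟩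
  d * (1000 ^ E * 1000 ^ s * count f a′ b′)
    ≡⟨ cong (λ x → d * (x * count f a′ b′))
            (trans (sym (^-distribˡ-+-* 1000 E s)) (cong (1000 ^_) (∸-sizes p≤a q≤b))) ⟩
  d * (1000 ^ (a + b) * count f a′ b′) ∎
  where
  open ≤-Reasoning
  p = length (primary ℓ)
  q = length (secondary ℓ)
  s = vertices ℓ
  k = a + 14 ∸ b + q ∸ p
  a′ = a ∸ p
  b′ = b ∸ q
  E = a′ + b′
  rearrange : ∀ v x m y → v * (x * m) * y ≡ v * (x * y) * m
  rearrange = solve-∀
  rearrange′ : ∀ d x c m → d * (x * c) * m ≡ d * (x * m * c)
  rearrange′ = solve-∀
  exponent : 8 ∸ s + (a + b ∸ 8) ≡ E
  exponent = +-cancelʳ-≡ s _ _ (begin-equality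
    8 ∸ s + (a + b ∸ 8) + s ≡⟨ xy∙z≈xz∙y (8 ∸ s) (a + b ∸ 8) s ⟩
    8 ∸ s + s + (a + b ∸ 8) ≡⟨ cong (_+ (a + b ∸ 8)) (m∸n+n≡m (IsLetter.size≤8 isLetter)) ⟩
    8 + (a + b ∸ 8)         ≡⟨ m+[n∸m]≡n 8≤a+b ⟩
    a + b                   ≡⟨ ∸-sizes p≤a q≤b ⟨
    E + s                   ∎)

growth-step : ∀ {d} f a b → 6 ≤ a → 6 ≤ b → b ≤ a + 14 →
  (∀ {ℓ} → IsLetter ℓ → Growth d f (a ∸ length (primary ℓ)) (b ∸ length (secondary ℓ))) →
  Growth d (suc f) a b
growth-step {d} f a b 6≤a 6≤b b≤a+14 growth = begin
  weight a b * 2234 ^ (a + b)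
    ≡⟨ cong (λ n → weight a b * 2234 ^ n) (m+[n∸m]≡n 8≤a+b) ⟨
  weight a b * 2234 ^ (8 + r)
    ≡⟨ trans (cong (weight a b *_) (^-distribˡ-+-* 2234 8 r)) (sym (*-assoc (weight a b) _ _)) ⟩
  weight a b * 2234 ^ 8 * 2234 ^ r
    ≤⟨ *-monoˡ-≤ (2234 ^ r) (potential-subsolution (a + 14 ∸ b)) ⟩
  transfer (a + 14 ∸ b) * 2234 ^ r
    ≡⟨ sum-map-*ʳ (transferTerm (a + 14 ∸ b)) (2234 ^ r) letters ⟨
  sum (map (λ ℓ → transferTerm (a + 14 ∸ b) ℓ * 2234 ^ r) letters)
    ≤⟨ sum-map-mono (All.map (λ isLetter → growth-letter {d} {f} isLetter (proj₁ (fit isLetter))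
                                (proj₂ (fit isLetter)) b≤a+14 8≤a+b (growth isLetter)) letters-isLetter) ⟩
  sum (map (λ ℓ → d * (1000 ^ (a + b) * count′ ℓ)) letters)
    ≡⟨ sum-map-*ˡ d (λ ℓ → 1000 ^ (a + b) * count′ ℓ) letters ⟩
  d * sum (map (λ ℓ → 1000 ^ (a + b) * count′ ℓ) letters)
    ≡⟨ cong (d *_) (sum-map-*ˡ (1000 ^ (a + b)) count′ letters) ⟩
  d * (1000 ^ (a + b) * sum (map count′ letters))
    ≤⟨ *-monoʳ-≤ d (*-monoʳ-≤ (1000 ^ (a + b)) (count-step f a b 6≤a 6≤b)) ⟩
  d * (1000 ^ (a + b) * count (suc f) a b) ∎
  where
  open ≤-Reasoning
  8≤a+b : 8 ≤ a + b
  8≤a+b = ≤-trans (m≤m+n 8 4) (+-mono-≤ 6≤a 6≤b)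
  r = a + b ∸ 8
  count′ : SBDS → ℕ
  count′ ℓ = count f (a ∸ length (primary ℓ)) (b ∸ length (secondary ℓ))
  fit : ∀ {ℓ} → IsLetter ℓ → length (primary ℓ) ≤ a × length (secondary ℓ) ≤ b
  fit = letter-fits 6≤a 6≤b

-- Below 20 vertices the constant absorbs everything; above, a nonzero weight forces a , b ≥ 6,
-- so that every letter can be split off.
growth : ∀ {d} → 1000 * 2234 ^ 20 ≤ d → ∀ f a b → a + b < f → Growth d f a b
growth {d} d-large (suc f) a b (s≤s a+b≤f) with a + b <? 20 | weight a b ≟ 0
... | yes small | _ = growth-small {d} (suc f) a b d-large small (count-pos (suc f) a b (s≤s a+b≤f))
... | no  _     | yes vanishes =
  subst (λ v → v * 2234 ^ (a + b) ≤ d * (1000 ^ (a + b) * count (suc f) a b)) (sym vanishes) z≤n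
... | no  large | no  nonzero with potential-support (a + 14 ∸ b) nonzero
... | 6≤k , k≤22 with band⇒large a b 6≤k k≤22 (≮⇒≥ large)
... | 6≤a , 6≤b , b≤a+14 =
  growth-step {d} f a b 6≤a 6≤b b≤a+14 (λ {ℓ} isLetter →
    growth d-large f (a ∸ length (primary ℓ)) (b ∸ length (secondary ℓ)) (smaller isLetter))
  where
  smaller : ∀ {ℓ} → IsLetter ℓ → (a ∸ length (primary ℓ)) + (b ∸ length (secondary ℓ)) < f
  smaller isLetter = let (p≤a , q≤b) = letter-fits 6≤a 6≤b isLetter in
    ≤-trans (m<m+n _ (IsLetter.nonempty isLetter)) (≤-trans (≤-reflexive (∸-sizes p≤a q≤b)) a+b≤f)

-- 2234² = 4990756 ≥ 4990000, so growth 2.234 per vertex is growth 4.99 per pair of vertices.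
exponential-lower-bound : ∀ {d} → 1000 * 2234 ^ 20 ≤ d → ∀ n →
  499 ^ n ≤ d * 100 ^ n * count (suc (n + n)) n n
exponential-lower-bound {d} d-large n = *-cancelʳ-≤ (499 ^ n) _ (10000 ^ n) {{m^n≢0 10000 n}} (begin
  499 ^ n * 10000 ^ n                   ≡⟨ ^-distribʳ-* 499 10000 n ⟨
  4990000 ^ n                           ≤⟨ ^-monoˡ-≤ n (≤ᵇ⇒≤ 4990000 4990756 _) ⟩
  (2234 * 2234) ^ n                     ≡⟨ ^-double 2234 n ⟨
  2234 ^ (n + n)                        ≤⟨ m≤n*m (2234 ^ (n + n)) (weight n n) {{weight-diagonal-nonzero}} ⟩
  weight n n * 2234 ^ (n + n)           ≤⟨ growth d-large (suc (n + n)) n n ≤-refl ⟩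
  d * (1000 ^ (n + n) * c)
    ≡⟨ cong (λ x → d * (x * c)) (trans (^-double 1000 n) (^-distribʳ-* 100 10000 n)) ⟩
  d * (100 ^ n * 10000 ^ n * c)         ≡⟨ rearrange d (100 ^ n) (10000 ^ n) c ⟩
  d * 100 ^ n * c * 10000 ^ n           ∎)
  where
  open ≤-Reasoning
  c = count (suc (n + n)) n n
  rearrange : ∀ d x y c → d * (x * y * c) ≡ d * x * c * y
  rearrange = solve-∀
  weight-diagonal-nonzero : NonZero (weight n n)
  weight-diagonal-nonzero rewrite m+n∸m≡n n 14 = _

lemma5p7 : ∃ λ (d : ℕ) → ∃ λ (N : ℕ) → (n : ℕ) → N ≤ n →
    ∃ λ (L : List SBDS) → Unique L × All (Counted n) L × 499 ^ n ≤ d * 100 ^ n * length L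
lemma5p7 = 1000 * 2234 ^ 20 , 0 , λ n _ →
  words (suc (n + n)) n n ,
  words-unique (suc (n + n)) n n ,
  All.map counted′⇒counted (words-counted′ (suc (n + n)) n n) ,
  exponential-lower-bound ≤-refl n
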